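{- Let $T$ be a finite rooted ordered tree with root $r$. The dual $T^*$ of $T$ (defined in the context) is a well-defined rooted ordered tree with root $r$.
   Context: Trees are finite, rooted and ordered. For a node $u$, $rmc_T(u)$ denotes its rightmost child in $T$ and $ils_T(u)$ its immediate left sibling in $T$ (when these exist). The dual $T^*$ of $T$ is the directed graph on the vertex set of $T$ whose parent function $\mathsf{pa}^*$ and sibling order are given by the rules: (1a) $r$ has no parent in $T^*$; (1b) if $v=rmc_T(r)$ then $v$ is the rightmost child of $r$ in $T^*$; (2) if $v=rmc_T(u)$ with $u\ne r$, then $v$ is the immediate left sibling of $u$ in $T^*$, so $\mathsf{pa}^*(v)=\mathsf{pa}^*(u)$; (3) if $v=ils_T(u)$, then $v$ is the rightmost child of $u$ in $T^*$, so $\mathsf{pa}^*(v)=u$. These rules assign each non-root node exactly one parent and a position among the nodes sharing that parent. -}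

module Defs where

open import Data.Nat using (ℕ; zero; suc)
open import Data.Fin using (Fin)
open import Data.Maybe using (Maybe; just; nothing; _>>=_)
open import Data.Product using (Σ; ∃; _×_)
open import Data.Sum using (_⊎_)
open import Relation.Binary.PropositionalEquality using (_≡_; _≢_)

iter : {A : Set} → (A → Maybe A) → ℕ → Maybe A → Maybe A
iter f zero    m = m
iter f (suc k) m = iter f k (m >>= f)

-- A finite rooted ordered tree on the vertex set Fin n.
--   pa  v = parent of v (nothing exactly for the root)
--   ils v = immediate left sibling of v (nothing if v is leftmost / root)
-- The siblings of each node form a single finite ils-chain.
record OrderedTree (n : ℕ) : Set where
  field
    root      : Fin n
    pa        : Fin n → Maybe (Fin n)
    ils       : Fin n → Maybe (Fin n)
    pa-root   : pa root ≡ nothing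
    pa-none   : ∀ v → pa v ≡ nothing → v ≡ root
    reach     : ∀ v → ∃ λ k → iter pa k (just v) ≡ just root
    ils-sib   : ∀ v w → ils v ≡ just w → pa w ≡ pa v
    ils-inj   : ∀ v v' w → ils v ≡ just w → ils v' ≡ just w → v ≡ v'
    ils-fin   : ∀ v → ∃ λ k → iter ils k (just v) ≡ nothing
    ils-total : ∀ v w p → pa v ≡ just p → pa w ≡ just p →
                (∃ λ k → iter ils k (just v) ≡ just w) ⊎
                (∃ λ k → iter ils k (just w) ≡ just v)

open OrderedTree public

RMC : ∀ {n} → OrderedTree n → Fin n → Fin n → Set
RMC T u v = pa T v ≡ just u × (∀ w → ils T w ≢ just v)

ILS : ∀ {n} → OrderedTree n → Fin n → Fin n → Set
ILS T u v = ils T u ≡ just v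

-- S satisfies the defining rules of the dual T* (rule (1a) is root S = root T,
-- stated separately).
record DualRules {n : ℕ} (T S : OrderedTree n) : Set where
  field
    rule1b : ∀ v → RMC T (root T) v → RMC S (root T) v
    rule2  : ∀ u v → RMC T u v → u ≢ root T → ILS S u v
    rule3  : ∀ u v → ILS T u v → RMC S u v

-- In T*, a node with a right sibling u in T hangs below u (rule 3), and the rightmost child
-- of p ≠ r becomes the left neighbour of p, hence shares p's T*-parent (rule 2); a rightmost
-- child of r hangs below r (rule 1b). So pa*(v) is found by climbing T from v until reaching a
-- node with a right sibling or a child of r, and ils*(u) is the T-rightmost child of u ≠ r;
-- since T is rooted this climb terminates and the rules force these values, which gives
-- uniqueness. Every node reaches r in T* by induction on its T-depth and, among siblings, on
-- the distance to the rightmost one. The T*-children of p form one ils*-chain descending in T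
-- from the node that rules (1b)/(3) make the rightmost one, so they are totally ordered, and
-- every ils*-chain is finite because each step goes one level down in T.
module Submission where

open import Defs
open import Data.Empty using (⊥-elim)
open import Data.Fin using (Fin)
open import Data.Fin.Properties using (any?) renaming (_≟_ to _≟ᶠ_)
open import Data.List using (map; allFin)
open import Data.List.Extrema.Nat using (max; xs≤max)
open import Data.List.Membership.Propositional.Properties using (∈-map⁺; ∈-allFin)
open import Data.List.Relation.Unary.All using (lookup)
open import Data.Maybe using (Maybe; just; nothing; _>>=_) renaming (map to mapᵐ)
open import Data.Maybe.Properties using (just-injective) renaming (≡-dec to ≡-decᵐ)
open import Data.Nat using (ℕ; zero; suc; _≤_; z≤n; s≤s)
open import Data.Nat.Properties using (n≤1+n)
open import Data.Product using (Σ; ∃; _×_; _,_; proj₁; proj₂)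
open import Data.Sum using (_⊎_; inj₁; inj₂)
open import Relation.Nullary using (¬_; Dec; yes; no)
open import Relation.Nullary.Decidable using (dec⇒maybe; _×-dec_)
open import Relation.Binary.PropositionalEquality
  using (_≡_; _≢_; refl; sym; trans; cong; subst; module ≡-Reasoning)
open ≡-Reasoning

module _ {A : Set} (f : A → Maybe A) where

  Terminates : A → Set
  Terminates x = ∃ λ k → iter f k (just x) ≡ nothing

  Reaches : A → A → Set
  Reaches x y = ∃ λ k → iter f k (just x) ≡ just y

  iter-nothing : ∀ k → iter f k nothing ≡ nothing
  iter-nothing zero    = refl
  iter-nothing (suc k) = iter-nothing k

  iter-suc : ∀ k m → iter f (suc k) m ≡ (iter f k m >>= f)
  iter-suc zero    m = refl
  iter-suc (suc k) m = iter-suc k (m >>= f)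

  iter-mono : ∀ {k j} m → iter f k m ≡ nothing → k ≤ j → iter f j m ≡ nothing
  iter-mono {j = j} m refl z≤n = iter-nothing j
  iter-mono m e (s≤s k≤j) = iter-mono (m >>= f) e k≤j

  iter-suc-just : ∀ k {x y} → iter f (suc k) (just x) ≡ just y → ∃ λ z → f z ≡ just y
  iter-suc-just k {x} e = bind-just (iter f k (just x)) (trans (sym (iter-suc k (just x))) e)
    where
    bind-just : ∀ m {y} → (m >>= f) ≡ just y → ∃ λ z → f z ≡ just y
    bind-just (just z) e = z , e

  reaches-step : ∀ {x y z} → f x ≡ just y → Reaches y z → Reaches x z
  reaches-step fx (k , e) = suc k , trans (cong (iter f k) fx) e

  reaches-extend : ∀ {x y z} → Reaches x y → f y ≡ just z → Reaches x z
  reaches-extend {x} (k , e) fy = suc k , trans (iter-suc k (just x)) (trans (cong (_>>= f) e) fy)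

  reaches-same-image : ∀ {x y z} → f x ≡ f y → y ≢ z → Reaches y z → Reaches x z
  reaches-same-image _  y≢z (zero , refl) = ⊥-elim (y≢z refl)
  reaches-same-image fx _ (suc k , e) = suc k , trans (cong (iter f k) fx) e

  reaches-comparable : ∀ {x v w} → Reaches x v → Reaches x w → Reaches v w ⊎ Reaches w v
  reaches-comparable (i , ei) (j , ej) = go i j _ ei ej
    where
    go : ∀ i j m {v w} → iter f i m ≡ just v → iter f j m ≡ just w → Reaches v w ⊎ Reaches w v
    go zero    j       _ refl ej   = inj₁ (j , ej)
    go (suc i) zero    _ ei   refl = inj₂ (suc i , ei)
    go (suc i) (suc j) m ei   ej   = go i j (m >>= f) ei ej

  iter-fixed : ∀ {x} → f x ≡ just x → ∀ k → iter f k (just x) ≡ just x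
  iter-fixed fx zero    = refl
  iter-fixed fx (suc k) = trans (cong (iter f k) fx) (iter-fixed fx k)

  no-fixed-point : ∀ {x} → Terminates x → f x ≢ just x
  no-fixed-point (k , e) fx with () ← trans (sym e) (iter-fixed fx k)

  terminating-induction : (Q : A → Set) → (∀ x → (∀ y → f x ≡ just y → Q y) → Q x) →
                          ∀ x → Terminates x → Q x
  terminating-induction Q step x (k , e) = go k x e
    where
    go : ∀ k x → iter f k (just x) ≡ nothing → Q x
    go (suc k) x e = step x λ y fx → go k y (trans (cong (iter f k) (sym fx)) e)

module _ {A : Set} {f g : A → Maybe A} (g⇒f⁻¹ : ∀ {x y} → g x ≡ just y → f y ≡ just x) where

  iter-reverse : ∀ k {v w} → iter g k (just v) ≡ just w → iter f k (just w) ≡ just v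
  iter-reverse zero refl = refl
  iter-reverse (suc k) {v} {w} e with g v in gv
  ... | nothing with () ← trans (sym e) (iter-nothing g k)
  ... | just u = trans (iter-suc f k (just w)) (trans (cong (_>>= f) (iter-reverse k e)) (g⇒f⁻¹ gv))

  terminates-reverse : ∀ B → (∀ w → iter f B (just w) ≡ nothing) →
                       ∀ v → iter g B (just v) ≡ nothing
  terminates-reverse B f-dies v with iter g B (just v) in e
  ... | nothing = refl
  ... | just w with () ← trans (sym (f-dies w)) (iter-reverse B e)

uniformly-terminates : ∀ {n} (f : Fin n → Maybe (Fin n)) → (∀ x → Terminates f x) →
                       ∃ λ B → ∀ x → iter f B (just x) ≡ nothing
uniformly-terminates {n} f term = B , λ x → iter-mono f (just x) (proj₂ (term x)) (time≤B x)
  where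
  time : Fin n → ℕ
  time x = proj₁ (term x)
  B : ℕ
  B = max 0 (map time (allFin n))
  time≤B : ∀ x → time x ≤ B
  time≤B x = lookup (xs≤max 0 (map time (allFin n))) (∈-map⁺ time (∈-allFin x))

just-ext : {A : Set} {a b : Maybe A} →
           (∀ x → a ≡ just x → b ≡ just x) → (∀ x → b ≡ just x → a ≡ just x) → a ≡ b
just-ext {a = just x}  a⇒b _   = sym (a⇒b x refl)
just-ext {a = nothing} {just y}  _ b⇒a = b⇒a y refl
just-ext {a = nothing} {nothing} _ _   = refl

module _ {n} {Q : Fin n → Set} where

  choose : Dec (∃ Q) → Maybe (Fin n)
  choose d = mapᵐ proj₁ (dec⇒maybe d)

  choose-just : ∀ d {w} → choose d ≡ just w → Q w
  choose-just (yes (w , q)) refl = q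

  choose-nothing : ∀ d → choose d ≡ nothing → ∀ w → ¬ Q w
  choose-nothing (no ¬∃) _ w q = ¬∃ (w , q)

  choose-unique : (∀ {w w'} → Q w → Q w' → w ≡ w') → ∀ d {w} → Q w → choose d ≡ just w
  choose-unique unique (yes (w' , q')) q = cong just (unique q' q)
  choose-unique unique (no ¬∃)         q = ⊥-elim (¬∃ (_ , q))

module _ {n} (T : OrderedTree n) where

  private
    r : Fin n
    r = root T

  private
    _≟ᵐ_ : (a b : Maybe (Fin n)) → Dec (a ≡ b)
    _≟ᵐ_ = ≡-decᵐ _≟ᶠ_

  pa-just⇒≢root : ∀ {v p} → pa T v ≡ just p → v ≢ r
  pa-just⇒≢root pv refl with () ← trans (sym (pa-root T)) pv

  ils-irreflexive : ∀ {x} → ils T x ≢ just x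
  ils-irreflexive {x} = no-fixed-point (ils T) (ils-fin T x)

  root-has-no-ils : ∀ {v} → ils T r ≢ just v
  root-has-no-ils {v} e with pa-none T v (trans (ils-sib T r v e) (pa-root T))
  ... | refl = ils-irreflexive e

  root-is-no-ils : ∀ {u} → ils T u ≢ just r
  root-is-no-ils {u} e with pa-none T u (trans (sym (ils-sib T u r e)) (pa-root T))
  ... | refl = ils-irreflexive e

  rightmost-unique : ∀ {u w w'} → RMC T u w → RMC T u w' → w ≡ w'
  rightmost-unique {u} {w} {w'} (pw , w-last) (pw' , w'-last) with ils-total T w w' u pw pw'
  ... | inj₁ (zero , refl) = refl
  ... | inj₂ (zero , refl) = refl
  ... | inj₁ (suc k , e) = let z , e' = iter-suc-just (ils T) k e in ⊥-elim (w'-last z e')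
  ... | inj₂ (suc k , e) = let z , e' = iter-suc-just (ils T) k e in ⊥-elim (w-last z e')

  parent-induction : (Q : Fin n → Set) → Q r → (∀ v p → pa T v ≡ just p → Q p → Q v) → ∀ v → Q v
  parent-induction Q Q-root Q-step v = go (proj₁ (reach T v)) v (proj₂ (reach T v))
    where
    go : ∀ k v → iter (pa T) k (just v) ≡ just r → Q v
    go zero    v refl = Q-root
    go (suc k) v e with pa T v in pv
    ... | nothing with () ← trans (sym e) (iter-nothing (pa T) k)
    ... | just p = Q-step v p pv (go k p e)

  pa-terminates : ∀ v → Terminates (pa T) v
  pa-terminates v =
    let k , e = reach T v
    in suc k , trans (iter-suc (pa T) k (just v)) (trans (cong (_>>= pa T) e) (pa-root T))

  rightSibling : Fin n → Maybe (Fin n)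
  rightSibling v = choose (any? λ u → ils T u ≟ᵐ just v)

  rightSibling-just : ∀ {v u} → rightSibling v ≡ just u → ILS T u v
  rightSibling-just = choose-just (any? _)

  rightSibling-nothing : ∀ {v} → rightSibling v ≡ nothing → ∀ u → ils T u ≢ just v
  rightSibling-nothing = choose-nothing (any? _)

  rightSibling-complete : ∀ {v u} → ILS T u v → rightSibling v ≡ just u
  rightSibling-complete = choose-unique (λ {u} {u'} e e' → ils-inj T u u' _ e e') (any? _)

  rightSibling-none : ∀ {v} → (∀ u → ils T u ≢ just v) → rightSibling v ≡ nothing
  rightSibling-none {v} last with rightSibling v in e
  ... | nothing = refl
  ... | just u with () ← last u (rightSibling-just e)

  rightmostChild : Fin n → Maybe (Fin n)
  rightmostChild u = choose (any? λ w → (pa T w ≟ᵐ just u) ×-dec (rightSibling w ≟ᵐ nothing))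

  rightmostChild-just : ∀ {u w} → rightmostChild u ≡ just w → RMC T u w
  rightmostChild-just e with choose-just (any? _) e
  ... | pw , last = pw , rightSibling-nothing last

  rightmostChild-complete : ∀ {u w} → RMC T u w → rightmostChild u ≡ just w
  rightmostChild-complete {u} (pw , last) =
    choose-unique unique (any? _) (pw , rightSibling-none last)
    where
    unique : ∀ {w w'} → pa T w ≡ just u × rightSibling w ≡ nothing →
             pa T w' ≡ just u × rightSibling w' ≡ nothing → w ≡ w'
    unique (pw , last) (pw' , last') =
      rightmost-unique (pw , rightSibling-nothing last) (pw' , rightSibling-nothing last')

  rightSibling-terminates : ∀ v → Terminates rightSibling v
  rightSibling-terminates v =
    let B , ils-dies = uniformly-terminates (ils T) (ils-fin T)
    in B , terminates-reverse rightSibling-just B ils-dies v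

module _ {n} {T S : OrderedTree n} (rootS : root S ≡ root T) (rules : DualRules T S) where

  open DualRules rules

  dual-pa-root : pa S (root T) ≡ nothing
  dual-pa-root = subst (λ t → pa S t ≡ nothing) rootS (pa-root S)

  dual-ils-just : ∀ {u w} → ils S u ≡ just w → u ≢ root T × RMC T u w
  dual-ils-just {u} {w} e with rightSibling T w in rw
  ... | just v with () ← proj₂ (rule3 v w (rightSibling-just T rw)) u e
  ... | nothing = from-parent (pa T w) refl
    where
    w-last : ∀ x → ils T x ≢ just w
    w-last = rightSibling-nothing T rw
    from-parent : ∀ m → pa T w ≡ m → u ≢ root T × RMC T u w
    from-parent nothing pw with refl ← pa-none T w pw =
      ⊥-elim (root-is-no-ils S (subst (λ t → ils S u ≡ just t) (sym rootS) e))
    from-parent (just p) pw with p ≟ᶠ root T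
    ... | yes refl with () ← proj₂ (rule1b w (pw , w-last)) u e
    ... | no p≢r with refl ← ils-inj S u p w e (rule2 p w (pw , w-last) p≢r) = p≢r , pw , w-last

  dual-ils-transfer : ∀ {S'} → DualRules T S' → ∀ {u w} → ils S u ≡ just w → ils S' u ≡ just w
  dual-ils-transfer rules' e with u≢r , rmc ← dual-ils-just e = DualRules.rule2 rules' _ _ rmc u≢r

module _ {n} {T S₁ S₂ : OrderedTree n}
         (root₁ : root S₁ ≡ root T) (rules₁ : DualRules T S₁)
         (root₂ : root S₂ ≡ root T) (rules₂ : DualRules T S₂) where

  private
    module R₁ = DualRules rules₁
    module R₂ = DualRules rules₂

  dual-ils-unique : ∀ u → ils S₁ u ≡ ils S₂ u
  dual-ils-unique u =
    just-ext (λ _ → dual-ils-transfer root₁ rules₁ rules₂) (λ _ → dual-ils-transfer root₂ rules₂ rules₁)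

  dual-pa-unique : ∀ v → pa S₁ v ≡ pa S₂ v
  dual-pa-unique = parent-induction T (λ v → pa S₁ v ≡ pa S₂ v)
    (trans (dual-pa-root root₁ rules₁) (sym (dual-pa-root root₂ rules₂))) step
    where
    step : ∀ v p → pa T v ≡ just p → pa S₁ p ≡ pa S₂ p → pa S₁ v ≡ pa S₂ v
    step v p pv IH with rightSibling T v in rv
    ... | just u = trans (proj₁ (R₁.rule3 u v ils-uv)) (sym (proj₁ (R₂.rule3 u v ils-uv)))
      where
      ils-uv : ILS T u v
      ils-uv = rightSibling-just T rv
    ... | nothing with p ≟ᶠ root T
    ...   | yes refl = trans (proj₁ (R₁.rule1b v rmc)) (sym (proj₁ (R₂.rule1b v rmc)))
      where
      rmc : RMC T (root T) v
      rmc = pv , rightSibling-nothing T rv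
    ...   | no p≢r = begin
      pa S₁ v ≡⟨ ils-sib S₁ p v (R₁.rule2 p v rmc p≢r) ⟩
      pa S₁ p ≡⟨ IH ⟩
      pa S₂ p ≡⟨ sym (ils-sib S₂ p v (R₂.rule2 p v rmc p≢r)) ⟩
      pa S₂ v ∎
      where
      rmc : RMC T p v
      rmc = pv , rightSibling-nothing T rv

module Dual {n} (T : OrderedTree n) where

  private
    r : Fin n
    r = root T

  -- climb f v is pa*(v) for v ≠ r (and r for v = r) once the fuel f exceeds the depth of v.
  climb : ℕ → Fin n → Fin n
  climb zero    v = v
  climb (suc f) v with rightSibling T v | pa T v
  ... | just u  | _       = u
  ... | nothing | nothing = v
  ... | nothing | just p  = climb f p

  climb-fuel : ∀ f g x → iter (pa T) f (just x) ≡ nothing → iter (pa T) g (just x) ≡ nothing →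
               climb f x ≡ climb g x
  climb-fuel (suc f) (suc g) x ef eg with rightSibling T x | pa T x
  ... | just u  | _       = refl
  ... | nothing | nothing = refl
  ... | nothing | just p  = climb-fuel f g p ef eg

  depth-bound : ℕ
  depth-bound = proj₁ (uniformly-terminates (pa T) (pa-terminates T))

  depth-bound-spec : ∀ v → iter (pa T) depth-bound (just v) ≡ nothing
  depth-bound-spec = proj₂ (uniformly-terminates (pa T) (pa-terminates T))

  dualParent : Fin n → Fin n
  dualParent = climb depth-bound

  dualParent-unfold : ∀ v → dualParent v ≡ climb (suc depth-bound) v
  dualParent-unfold v = climb-fuel depth-bound (suc depth-bound) v (depth-bound-spec v)
    (iter-mono (pa T) (just v) (depth-bound-spec v) (n≤1+n depth-bound))

  dualParent-sibling : ∀ {v u} → rightSibling T v ≡ just u → dualParent v ≡ u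
  dualParent-sibling {v} rv rewrite dualParent-unfold v | rv = refl

  dualParent-up : ∀ {v p} → rightSibling T v ≡ nothing → pa T v ≡ just p → dualParent v ≡ dualParent p
  dualParent-up {v} rv pv rewrite dualParent-unfold v | rv | pv = refl

  dualParent-root : dualParent r ≡ r
  dualParent-root
    rewrite dualParent-unfold r | rightSibling-none T (λ u → root-is-no-ils T) | pa-root T = refl

  dualPa : Fin n → Maybe (Fin n)
  dualPa v with v ≟ᶠ r
  ... | yes _ = nothing
  ... | no  _ = just (dualParent v)

  dualIls : Fin n → Maybe (Fin n)
  dualIls u with u ≟ᶠ r
  ... | yes _ = nothing
  ... | no  _ = rightmostChild T u

  dualPa-root : dualPa r ≡ nothing
  dualPa-root with r ≟ᶠ r
  ... | yes _   = refl
  ... | no  r≢r = ⊥-elim (r≢r refl)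

  dualPa-nonroot : ∀ {v} → v ≢ r → dualPa v ≡ just (dualParent v)
  dualPa-nonroot {v} v≢r with v ≟ᶠ r
  ... | yes v≡r = ⊥-elim (v≢r v≡r)
  ... | no  _   = refl

  dualPa-nothing : ∀ {v} → dualPa v ≡ nothing → v ≡ r
  dualPa-nothing {v} e with v ≟ᶠ r
  ... | yes v≡r = v≡r

  dualPa-just : ∀ {v p} → dualPa v ≡ just p → v ≢ r × dualParent v ≡ p
  dualPa-just {v} e with v ≟ᶠ r
  ... | no v≢r = v≢r , just-injective e

  dualIls-nonroot : ∀ {u} → u ≢ r → dualIls u ≡ rightmostChild T u
  dualIls-nonroot {u} u≢r with u ≟ᶠ r
  ... | yes u≡r = ⊥-elim (u≢r u≡r)
  ... | no  _   = refl

  dualIls-just : ∀ {u w} → dualIls u ≡ just w → u ≢ r × RMC T u w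
  dualIls-just {u} e with u ≟ᶠ r
  ... | no u≢r = u≢r , rightmostChild-just T e

  dualIls⇒pa : ∀ {u w} → dualIls u ≡ just w → pa T w ≡ just u
  dualIls⇒pa e = proj₁ (proj₂ (dualIls-just e))

  dualPa-up : ∀ {v p} → rightSibling T v ≡ nothing → pa T v ≡ just p → p ≢ r → dualPa v ≡ dualPa p
  dualPa-up {v} {p} rv pv p≢r = begin
    dualPa v            ≡⟨ dualPa-nonroot (pa-just⇒≢root T pv) ⟩
    just (dualParent v) ≡⟨ cong just (dualParent-up rv pv) ⟩
    just (dualParent p) ≡⟨ sym (dualPa-nonroot p≢r) ⟩
    dualPa p            ∎

  dualIls-sib : ∀ {u w} → dualIls u ≡ just w → dualPa w ≡ dualPa u
  dualIls-sib e with u≢r , pw , w-last ← dualIls-just e = dualPa-up (rightSibling-none T w-last) pw u≢r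

  children-reach-root : ∀ {p} → Reaches dualPa p r → ∀ w → pa T w ≡ just p → Reaches dualPa w r
  children-reach-root {p} p-reaches w =
    terminating-induction (rightSibling T) (λ w → pa T w ≡ just p → Reaches dualPa w r) step w
      (rightSibling-terminates T w)
    where
    step : ∀ w → (∀ u → rightSibling T w ≡ just u → pa T u ≡ just p → Reaches dualPa u r) →
           pa T w ≡ just p → Reaches dualPa w r
    step w IH pw with rightSibling T w in rw
    ... | just u = reaches-step dualPa (trans (dualPa-nonroot w≢r) (cong just (dualParent-sibling rw)))
                     (IH u refl (trans (sym (ils-sib T u w (rightSibling-just T rw))) pw))
      where
      w≢r : w ≢ r
      w≢r = pa-just⇒≢root T pw
    ... | nothing with p ≟ᶠ r
    ...   | yes refl = 1 , trans (dualPa-nonroot (pa-just⇒≢root T pw))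
                             (cong just (trans (dualParent-up rw pw) dualParent-root))
    ...   | no p≢r = reaches-same-image dualPa (dualPa-up rw pw p≢r) p≢r p-reaches

  dual-reaches-root : ∀ v → Reaches dualPa v r
  dual-reaches-root = parent-induction T (λ v → Reaches dualPa v r) (0 , refl)
    λ v p pv p-reaches → children-reach-root p-reaches v pv

  -- The rightmost child of p in T*, as prescribed by rules (1b) and (3).
  DualRightmost : Fin n → Fin n → Set
  DualRightmost p x = (p ≡ r × RMC T r x) ⊎ (p ≢ r × ILS T p x)

  dualRightmost-unique : ∀ {p x x'} → DualRightmost p x → DualRightmost p x' → x ≡ x'
  dualRightmost-unique (inj₁ (_ , rmc))   (inj₁ (_ , rmc'))  = rightmost-unique T rmc rmc'
  dualRightmost-unique (inj₁ (p≡r , _))   (inj₂ (p≢r , _))   = ⊥-elim (p≢r p≡r)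
  dualRightmost-unique (inj₂ (p≢r , _))   (inj₁ (p≡r , _))   = ⊥-elim (p≢r p≡r)
  dualRightmost-unique (inj₂ (_ , ils-x)) (inj₂ (_ , ils-x')) = just-injective (trans (sym ils-x) ils-x')

  dual-sibling-chain : ∀ v → v ≢ r → ∃ λ x → DualRightmost (dualParent v) x × Reaches dualIls x v
  dual-sibling-chain = parent-induction T Chain (λ r≢r → ⊥-elim (r≢r refl)) step
    where
    Chain : Fin n → Set
    Chain v = v ≢ r → ∃ λ x → DualRightmost (dualParent v) x × Reaches dualIls x v
    step : ∀ v q → pa T v ≡ just q → Chain q → Chain v
    step v q pv IH v≢r with rightSibling T v in rv
    ... | just u rewrite dualParent-sibling rv =
      v , inj₂ ((λ { refl → root-has-no-ils T ils-uv }) , ils-uv) , 0 , refl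
      where
      ils-uv : ILS T u v
      ils-uv = rightSibling-just T rv
    ... | nothing rewrite dualParent-up rv pv with q ≟ᶠ r
    ...   | yes refl rewrite dualParent-root = v , inj₁ (refl , pv , rightSibling-nothing T rv) , 0 , refl
    ...   | no q≢r with x , rm , chain ← IH q≢r =
      x , rm , reaches-extend dualIls chain
                 (trans (dualIls-nonroot q≢r) (rightmostChild-complete T (pv , rightSibling-nothing T rv)))

  dualIls-total : ∀ v w p → dualPa v ≡ just p → dualPa w ≡ just p →
                  Reaches dualIls v w ⊎ Reaches dualIls w v
  dualIls-total v w p pv pw =
    let v≢r , v↦p = dualPa-just pv
        w≢r , w↦p = dualPa-just pw
        x  , rm  , x⇝v  = dual-sibling-chain v v≢r
        x' , rm' , x'⇝w = dual-sibling-chain w w≢r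
        x≡x' = dualRightmost-unique (subst (λ q → DualRightmost q x) v↦p rm)
                                    (subst (λ q → DualRightmost q x') w↦p rm')
    in reaches-comparable dualIls x⇝v (subst (λ y → Reaches dualIls y w) (sym x≡x') x'⇝w)

  dual : OrderedTree n
  dual = record
    { root      = r
    ; pa        = dualPa
    ; ils       = dualIls
    ; pa-root   = dualPa-root
    ; pa-none   = λ _ → dualPa-nothing
    ; reach     = dual-reaches-root
    ; ils-sib   = λ _ _ → dualIls-sib
    ; ils-inj   = λ _ _ _ e e' → just-injective (trans (sym (dualIls⇒pa e)) (dualIls⇒pa e'))
    ; ils-fin   = λ v → depth-bound , terminates-reverse dualIls⇒pa depth-bound depth-bound-spec v
    ; ils-total = dualIls-total
    }

  dual-rules : DualRules T dual
  dual-rules = record { rule1b = rule1b ; rule2 = rule2 ; rule3 = rule3 }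
    where
    rule1b : ∀ v → RMC T r v → RMC dual r v
    rule1b v (pv , v-last) =
      trans (dualPa-nonroot (pa-just⇒≢root T pv))
            (cong just (trans (dualParent-up (rightSibling-none T v-last) pv) dualParent-root)) ,
      λ w e → let w≢r , pv' , _ = dualIls-just {w} e in w≢r (just-injective (trans (sym pv') pv))

    rule2 : ∀ u v → RMC T u v → u ≢ r → ILS dual u v
    rule2 u v rmc u≢r = trans (dualIls-nonroot u≢r) (rightmostChild-complete T rmc)

    rule3 : ∀ u v → ILS T u v → RMC dual u v
    rule3 u v ils-uv =
      trans (dualPa-nonroot v≢r) (cong just (dualParent-sibling (rightSibling-complete T ils-uv))) ,
      λ w e → proj₂ (proj₂ (dualIls-just {w} e)) u ils-uv
      where
      v≢r : v ≢ r
      v≢r refl = root-is-no-ils T ils-uv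

theorem2 : ∀ {n} (T : OrderedTree n) →
    Σ (OrderedTree n) λ S →
      root S ≡ root T × DualRules T S ×
      ((S' : OrderedTree n) → root S' ≡ root T → DualRules T S' →
        ((v : Fin n) → pa S' v ≡ pa S v) × ((v : Fin n) → ils S' v ≡ ils S v))
theorem2 T = dual , refl , dual-rules , λ S' root' rules' →
  dual-pa-unique root' rules' refl dual-rules , dual-ils-unique root' rules' refl dual-rules
  where open Dual T
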